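{- Let $q\geq 7$ be a prime power and let $k\geq 1$ be an integer such that $q-1=4k+R$ for some $R\in\{1,2,3,4,5\}$. Then the mixed graph $H_q$ (constructed from $q$, $k$ and a primitive element $\xi$ of $\mathbb{F}_q$ as described in the context) has girth $5$.
   Context: A mixed graph $G=(V;E\cup A)$ has a vertex set $V$, a set $E$ of (undirected) edges and a set $A$ of arcs (directed), with no parallel edges, no parallel arcs, and no arc parallel to an edge. A cycle is a sequence of distinct vertices $(v_0,\dots,v_{n-1})$ such that for every $i$ (indices mod $n$) either the edge $v_iv_{i+1}$ or the arc $(v_i,v_{i+1})$ is present (arcs may only be traversed in their direction, and no edge is used twice); its length is $n$. The girth is the length of a shortest cycle. Construction of $H_q$. Let $\mathbb{F}_q$ be the field with $q$ elements, $\mathbb{F}_q^*=\mathbb{F}_q\setminus\{0\}$, and $\xi$ a primitive element (generator of the multiplicative group $\mathbb{F}_q^*$). The vertex set consists of: "points" $(x,y)$ with $x\in\mathbb{F}_q^*$, $y\in\mathbb{F}_q$; "lines" $[m,b]$ with $m\in\mathbb{F}_q^*$, $b\in\mathbb{F}_q$; vertices $L_i$ for $i\in\mathbb{F}_q^*$; and vertices $P_i$ for $i\in\mathbb{F}_q^*$ (so $2(q^2-1)$ vertices). Edges: $(x,y)[m,b]$ whenever $y=mx+b$; $(x,y)L_x$ for every point $(x,y)$; $[m,b]P_m$ for every line $[m,b]$; there are no other edges (this is the incidence graph of the projective plane $PG(2,q)$ with the line $x=0$ and its points, and the point at infinity of vertical lines together with its lines, removed). Arcs: for every $i\in\{1,\dots,k\}$,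 all arcs $((x,y),(x\xi^i,y))$ for $x\in\mathbb{F}_q^*$, $y\in\mathbb{F}_q$; $(L_x,L_{x\xi^i})$ for $x\in\mathbb{F}_q^*$; $([m,b],[m/\xi^i,b])$ for $m\in\mathbb{F}_q^*$, $b\in\mathbb{F}_q$; and $(P_m,P_{m/\xi^i})$ for $m\in\mathbb{F}_q^*$. -}

module Defs where

open import Level using (0ℓ)
open import Data.Nat using (ℕ; zero; suc; _≤_; _<_; NonZero)
open import Data.Fin using (Fin)
open import Data.Product using (Σ; _×_; ∃-syntax)
open import Data.Sum using (_⊎_)
open import Relation.Nullary using (¬_)
open import Relation.Binary.PropositionalEquality using (_≡_; _≢_)
open import Algebra.Structures using (IsCommutativeRing)

-- The standard library has no
-- field bundle, so we define one: a commutative ring with 0 ≠ 1 in which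
-- every nonzero element has a multiplicative inverse (the inverse
-- operation is total; its value at 0 is irrelevant).

record Field : Set₁ where
  infixl 7 _*_
  infixl 6 _+_
  field
    Carrier : Set
    _+_ _*_ : Carrier → Carrier → Carrier
    -_ : Carrier → Carrier
    0# 1# : Carrier
    isCommutativeRing : IsCommutativeRing _≡_ _+_ _*_ -_ 0# 1#
    0≢1 : 0# ≢ 1#
    _⁻¹ : Carrier → Carrier
    ⁻¹-inverse : ∀ x → x ≢ 0# → x * (x ⁻¹) ≡ 1#

  _^_ : Carrier → ℕ → Carrier
  x ^ zero = 1#
  x ^ suc n = x * (x ^ n)

  _/_ : Carrier → Carrier → Carrier
  x / y = x * (y ⁻¹)

  IsPrimitive : Carrier → Set
  IsPrimitive ξ = (ξ ≢ 0#) × (∀ x → x ≢ 0# → ∃[ j ] (ξ ^ j ≡ x))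

open Field using (Carrier)

HasSize : Field → ℕ → Set
HasSize F q = Σ (Fin q → Carrier F) λ f →
  (∀ i j → f i ≡ f j → i ≡ j) × (∀ x → ∃[ i ] (f i ≡ x))

record MixedGraph : Set₁ where
  field
    V : Set
    E : V → V → Set
    A : V → V → Set

  Edge : V → V → Set
  Edge u v = E u v ⊎ E v u

  data Step (u v : V) : Set where
    edge : Edge u v → Step u v
    arc  : A u v → Step u v

  IsEdgeStep : ∀ {u v} → Step u v → Set
  IsEdgeStep (edge _) = Data.Unit.⊤ where import Data.Unit
  IsEdgeStep (arc _)  = Data.Empty.⊥ where import Data.Empty

  next : ∀ {n} → Fin n → Fin n
  next {suc n} i = Data.Fin.fromℕ< {Data.Nat._%_ (suc (Data.Fin.toℕ i)) (suc n)}
                     (Data.Nat.DivMod.m%n<n (suc (Data.Fin.toℕ i)) (suc n))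
    where import Data.Nat.DivMod

  record Cycle (n : ℕ) : Set where
    field
      n≥1      : 1 ≤ n
      vtx      : Fin n → V
      distinct : ∀ i j → vtx i ≡ vtx j → i ≡ j
      step     : (i : Fin n) → Step (vtx i) (vtx (next i))
      edgesOnce : ∀ i j → i ≢ j → IsEdgeStep (step i) → IsEdgeStep (step j) →
                  ¬ ((vtx i ≡ vtx (next j)) × (vtx (next i) ≡ vtx j))

  HasGirth : ℕ → Set
  HasGirth g = Cycle g × (∀ n → n < g → ¬ Cycle n)

module Construction (F : Field) (k : ℕ) (ξ : Carrier F) where
  open Field F renaming (Carrier to 𝔽)

  data Vtx : Set where
    point : (x : 𝔽) → .(x ≢ 0#) → (y : 𝔽) → Vtx
    line  : (m : 𝔽) → .(m ≢ 0#) → (b : 𝔽) → Vtx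
    L     : (i : 𝔽) → .(i ≢ 0#) → Vtx
    P     : (i : 𝔽) → .(i ≢ 0#) → Vtx

  Inc : Vtx → Vtx → Set
  Inc (point x _ y) (line m _ b) = y ≡ m * x + b
  Inc (point x _ y) (L i _)      = i ≡ x
  Inc (line m _ b)  (P i _)      = i ≡ m
  Inc _ _ = Data.Empty.⊥ where import Data.Empty

  InRange : ℕ → Set
  InRange i = (1 ≤ i) × (i ≤ k)

  Arc : Vtx → Vtx → Set
  Arc (point x _ y) (point x' _ y') = ∃[ i ] (InRange i × (x' ≡ x * (ξ ^ i)) × (y' ≡ y))
  Arc (L x _)       (L x' _)        = ∃[ i ] (InRange i × (x' ≡ x * (ξ ^ i)))
  Arc (line m _ b)  (line m' _ b')  = ∃[ i ] (InRange i × (m' ≡ m / (ξ ^ i)) × (b' ≡ b))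
  Arc (P m _)       (P m' _)        = ∃[ i ] (InRange i × (m' ≡ m / (ξ ^ i)))
  Arc _ _ = Data.Empty.⊥ where import Data.Empty

  H : MixedGraph
  H = record { V = Vtx ; E = Inc ; A = Arc }

module Submission where

-- For S ∈ ℕ let σ^S map (x,y) ↦ (xξ^S, y), [m,b] ↦ [m/ξ^S, b], L_x ↦ L_{xξ^S} and P_m ↦ P_{m/ξ^S}.
-- It preserves incidence, so it is an automorphism of the undirected part G of H_q, and the arcs of H_q
-- are exactly the pairs (v, σ^i v) with 1 ≤ i ≤ k. Undoing the twists along a closed walk v → … → v of
-- length n ≤ 4 containing a ≥ 1 arcs, of total exponent S, gives a walk of n - a ≤ 3 edges of G from
-- σ^S v to v. But 1 ≤ S ≤ 4k < q - 1, so ξ^S ≠ 1, hence σ^S v ≠ v; moreover σ^S v and v lie on the same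
-- side of the bipartite graph G and have no common neighbour. Closed walks without arcs are closed walks
-- of G, and G is bipartite without quadrangles (two lines meet at most once). Finally
-- L_1 → L_ξ — (ξ,ξ) — [1,0] — (1,1) — L_1 is a cycle of length 5.

open import Defs
open import Level using (0ℓ)
open import Data.Nat as ℕ using (ℕ; zero; suc; NonZero; _≤_; _<_; z≤n; s≤s)
import Data.Nat.Properties as ℕP
open import Data.Nat.DivMod using (_%_; m≡m%n+[m/n]*n; m%n<n)
open import Data.Nat.Primality using (Prime)
open import Data.Bool using (Bool; true; false; not)
open import Data.Bool.Properties using (not-¬; not-involutive)
open import Data.Empty using (⊥; ⊥-elim)
open import Data.Fin as Fin using (Fin; zero; suc; #_; fromℕ<; toℕ)
open import Data.Fin.Properties using (injective⇒≤; toℕ-fromℕ<; suc-injective)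
open import Data.Product using (∃-syntax; _×_; _,_; proj₁; proj₂)
open import Data.Sum using (inj₁; inj₂)
open import Data.Unit using (tt)
open import Function using (_∘_; case_of_)
open import Relation.Nullary using (¬_; yes; no)
import Relation.Nullary.Decidable as Dec
open import Relation.Nullary.Recomputable using (¬-recompute)
open import Relation.Binary.Definitions using (DecidableEquality)
open import Relation.Binary.PropositionalEquality
  using (_≡_; _≢_; refl; sym; trans; cong; cong₂; subst; module ≡-Reasoning)
open import Algebra.Bundles using (CommutativeRing)
open import Algebra.Structures using (IsCommutativeRing)

module FieldProperties (F : Field) where
  open Field F
  open IsCommutativeRing isCommutativeRing
    using (+-assoc; +-comm; +-identityˡ; -‿inverseˡ; *-assoc; *-comm; *-identityˡ; *-identityʳ; zeroʳ)
  open ≡-Reasoning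

  commutativeRing : CommutativeRing 0ℓ 0ℓ
  commutativeRing = record
    { _+_ = _+_ ; _*_ = _*_ ; -_ = -_ ; 0# = 0# ; 1# = 1#
    ; isCommutativeRing = isCommutativeRing }

  open CommutativeRing commutativeRing using (+-group; ring; _-_)
  open import Algebra.Definitions (_≡_ {A = Carrier})
    using (AlmostLeftCancellative; AlmostRightCancellative)
  open import Algebra.Consequences.Setoid (CommutativeRing.setoid commutativeRing)
    using (comm∧almostCancelˡ⇒almostCancelʳ)
  open import Algebra.Properties.Group +-group public
    using () renaming (∙-cancelˡ to +-cancelˡ; ∙-cancelʳ to +-cancelʳ; x∙y⁻¹≈ε⇒x≈y to x-y≡0⇒x≡y)
  open import Algebra.Properties.Ring ring using ([y-z]x≈yx-zx)

  *-almostCancelˡ : AlmostLeftCancellative 0# _*_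
  *-almostCancelˡ x y z x≢0 xy≡xz = begin
    y                ≡⟨ sym (*-identityˡ y) ⟩
    1# * y           ≡⟨ cong (_* y) (trans (sym (⁻¹-inverse x x≢0)) (*-comm x (x ⁻¹))) ⟩
    x ⁻¹ * x * y     ≡⟨ *-assoc (x ⁻¹) x y ⟩
    x ⁻¹ * (x * y)   ≡⟨ cong (x ⁻¹ *_) xy≡xz ⟩
    x ⁻¹ * (x * z)   ≡⟨ sym (*-assoc (x ⁻¹) x z) ⟩
    x ⁻¹ * x * z     ≡⟨ cong (_* z) (trans (*-comm (x ⁻¹) x) (⁻¹-inverse x x≢0)) ⟩
    1# * z           ≡⟨ *-identityˡ z ⟩
    z                ∎

  *-almostCancelʳ : AlmostRightCancellative 0# _*_
  *-almostCancelʳ = comm∧almostCancelˡ⇒almostCancelʳ *-comm *-almostCancelˡ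

  x*y≢0 : ∀ {x y} → x ≢ 0# → y ≢ 0# → x * y ≢ 0#
  x*y≢0 {x} {y} x≢0 y≢0 xy≡0 = y≢0 (*-almostCancelˡ x y 0# x≢0 (trans xy≡0 (sym (zeroʳ x))))

  1≢0 : 1# ≢ 0#
  1≢0 1≡0 = 0≢1 (sym 1≡0)

  x⁻¹≢0 : ∀ {x} → x ≢ 0# → x ⁻¹ ≢ 0#
  x⁻¹≢0 {x} x≢0 x⁻¹≡0 = 1≢0 (trans (sym (⁻¹-inverse x x≢0)) (trans (cong (x *_) x⁻¹≡0) (zeroʳ x)))

  x/y≢0 : ∀ {x y} → x ≢ 0# → y ≢ 0# → x / y ≢ 0#
  x/y≢0 x≢0 y≢0 = x*y≢0 x≢0 (x⁻¹≢0 y≢0)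

  x/1≡x : ∀ x → x / 1# ≡ x
  x/1≡x x = trans (cong (x *_) 1⁻¹≡1) (*-identityʳ x)
    where
    1⁻¹≡1 : 1# ⁻¹ ≡ 1#
    1⁻¹≡1 = trans (sym (*-identityˡ (1# ⁻¹))) (⁻¹-inverse 1# 1≢0)

  x^n≢0 : ∀ {x} n → x ≢ 0# → x ^ n ≢ 0#
  x^n≢0 zero    _   = 1≢0
  x^n≢0 (suc n) x≢0 = x*y≢0 x≢0 (x^n≢0 n x≢0)

  ^-distribˡ-+-* : ∀ x m n → x ^ (m ℕ.+ n) ≡ x ^ m * x ^ n
  ^-distribˡ-+-* x zero    n = sym (*-identityˡ (x ^ n))
  ^-distribˡ-+-* x (suc m) n = begin
    x * x ^ (m ℕ.+ n)      ≡⟨ cong (x *_) (^-distribˡ-+-* x m n) ⟩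
    x * (x ^ m * x ^ n)    ≡⟨ sym (*-assoc x (x ^ m) (x ^ n)) ⟩
    x * x ^ m * x ^ n      ∎

  x*y≡x⇒y≡1 : ∀ {x y} → x ≢ 0# → x * y ≡ x → y ≡ 1#
  x*y≡x⇒y≡1 {x} {y} x≢0 xy≡x = *-almostCancelˡ x y 1# x≢0 (trans xy≡x (sym (*-identityʳ x)))

  x/y*y≡x : ∀ x {y} → y ≢ 0# → x / y * y ≡ x
  x/y*y≡x x {y} y≢0 = begin
    x * y ⁻¹ * y     ≡⟨ *-assoc x (y ⁻¹) y ⟩
    x * (y ⁻¹ * y)   ≡⟨ cong (x *_) (trans (*-comm (y ⁻¹) y) (⁻¹-inverse y y≢0)) ⟩
    x * 1#           ≡⟨ *-identityʳ x ⟩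
    x                ∎

  x/y≡x⇒y≡1 : ∀ {x y} → x ≢ 0# → y ≢ 0# → x / y ≡ x → y ≡ 1#
  x/y≡x⇒y≡1 {x} {y} x≢0 y≢0 x/y≡x =
    x*y≡x⇒y≡1 x≢0 (trans (cong (_* y) (sym x/y≡x)) (x/y*y≡x x y≢0))

  x/y*[z*y]≡x*z : ∀ x {y} z → y ≢ 0# → x / y * (z * y) ≡ x * z
  x/y*[z*y]≡x*z x {y} z y≢0 = begin
    x / y * (z * y)   ≡⟨ cong (x / y *_) (*-comm z y) ⟩
    x / y * (y * z)   ≡⟨ sym (*-assoc (x / y) y z) ⟩
    x / y * y * z     ≡⟨ cong (_* z) (x/y*y≡x x y≢0) ⟩
    x * z             ∎

  x/y/z≡x/[y*z] : ∀ x {y z} → y ≢ 0# → z ≢ 0# → (x / y) / z ≡ x / (y * z)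
  x/y/z≡x/[y*z] x {y} {z} y≢0 z≢0 = *-almostCancelʳ (y * z) _ _ (x*y≢0 y≢0 z≢0) (begin
    (x / y) / z * (y * z) ≡⟨ x/y*[z*y]≡x*z (x / y) y z≢0 ⟩
    x / y * y             ≡⟨ x/y*y≡x x y≢0 ⟩
    x                     ≡⟨ sym (x/y*y≡x x (x*y≢0 y≢0 z≢0)) ⟩
    x / (y * z) * (y * z) ∎)

  x^n≡1⇒x^[m*n]≡1 : ∀ {x n} → x ^ n ≡ 1# → ∀ m → x ^ (m ℕ.* n) ≡ 1#
  x^n≡1⇒x^[m*n]≡1 x^n≡1 zero    = refl
  x^n≡1⇒x^[m*n]≡1 {x} {n} x^n≡1 (suc m) = begin
    x ^ (n ℕ.+ m ℕ.* n)      ≡⟨ ^-distribˡ-+-* x n (m ℕ.* n) ⟩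
    x ^ n * x ^ (m ℕ.* n)    ≡⟨ cong₂ _*_ x^n≡1 (x^n≡1⇒x^[m*n]≡1 x^n≡1 m) ⟩
    1# * 1#                  ≡⟨ *-identityˡ 1# ⟩
    1#                       ∎

  x^n≡1⇒x^m≡x^[m%n] : ∀ {x n} .{{_ : NonZero n}} → x ^ n ≡ 1# → ∀ m → x ^ m ≡ x ^ (m % n)
  x^n≡1⇒x^m≡x^[m%n] {x} {n} x^n≡1 m = begin
    x ^ m                              ≡⟨ cong (x ^_) (m≡m%n+[m/n]*n m n) ⟩
    x ^ (m % n ℕ.+ m ℕ./ n ℕ.* n)      ≡⟨ ^-distribˡ-+-* x (m % n) _ ⟩
    x ^ (m % n) * x ^ (m ℕ./ n ℕ.* n)  ≡⟨ cong (x ^ (m % n) *_) (x^n≡1⇒x^[m*n]≡1 x^n≡1 (m ℕ./ n)) ⟩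
    x ^ (m % n) * 1#                   ≡⟨ *-identityʳ _ ⟩
    x ^ (m % n)                        ∎

  x*y^m*y^n≡x*y^[m+n] : ∀ x y m n → x * y ^ m * y ^ n ≡ x * y ^ (m ℕ.+ n)
  x*y^m*y^n≡x*y^[m+n] x y m n =
    trans (*-assoc x (y ^ m) (y ^ n)) (cong (x *_) (sym (^-distribˡ-+-* y m n)))

  x/y^m/y^n≡x/y^[m+n] : ∀ x {y} m n → y ≢ 0# → (x / (y ^ m)) / (y ^ n) ≡ x / (y ^ (m ℕ.+ n))
  x/y^m/y^n≡x/y^[m+n] x {y} m n y≢0 =
    trans (x/y/z≡x/[y*z] x (x^n≢0 m y≢0) (x^n≢0 n y≢0)) (cong (x /_) (sym (^-distribˡ-+-* y m n)))

  x-y+[y+z]≡x+z : ∀ x y z → x - y + (y + z) ≡ x + z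
  x-y+[y+z]≡x+z x y z = begin
    x - y + (y + z)     ≡⟨ +-assoc x (- y) (y + z) ⟩
    x + (- y + (y + z)) ≡⟨ cong (x +_) (sym (+-assoc (- y) y z)) ⟩
    x + (- y + y + z)   ≡⟨ cong (λ w → x + (w + z)) (-‿inverseˡ y) ⟩
    x + (0# + z)        ≡⟨ cong (x +_) (+-identityˡ z) ⟩
    x + z               ∎

  x+y≡z+w⇒x-z≡w-y : ∀ {x y z w} → x + y ≡ z + w → x - z ≡ w - y
  x+y≡z+w⇒x-z≡w-y {x} {y} {z} {w} eq = +-cancelʳ (z + y) (x - z) (w - y) (begin
    x - z + (z + y)   ≡⟨ x-y+[y+z]≡x+z x z y ⟩
    x + y             ≡⟨ eq ⟩
    z + w             ≡⟨ +-comm z w ⟩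
    w + z             ≡⟨ sym (x-y+[y+z]≡x+z w y z) ⟩
    w - y + (y + z)   ≡⟨ cong (w - y +_) (+-comm y z) ⟩
    w - y + (z + y)   ∎)

  affine-agree-once : ∀ {m m' b b' x x'} → m ≢ m' →
    m * x + b ≡ m' * x + b' → m * x' + b ≡ m' * x' + b' → x ≡ x'
  affine-agree-once {m} {m'} {b} {b'} {x} {x'} m≢m' at-x at-x' =
    *-almostCancelˡ (m - m') x x' (m≢m' ∘ x-y≡0⇒x≡y m m') (begin
      (m - m') * x      ≡⟨ [y-z]x≈yx-zx x m m' ⟩
      m * x - m' * x    ≡⟨ x+y≡z+w⇒x-z≡w-y at-x ⟩
      b' - b            ≡⟨ sym (x+y≡z+w⇒x-z≡w-y at-x') ⟩
      m * x' - m' * x'  ≡⟨ sym ([y-z]x≈yx-zx x' m m') ⟩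
      (m - m') * x'     ∎)

module FiniteField (F : Field) {q} (size : HasSize F q) where
  open Field F
  open FieldProperties F
  open ≡-Reasoning

  private
    enum : Fin q → Carrier
    enum = proj₁ size

    enum-injective : ∀ i j → enum i ≡ enum j → i ≡ j
    enum-injective = proj₁ (proj₂ size)

    index : Carrier → Fin q
    index x = proj₁ (proj₂ (proj₂ size) x)

    enum-index : ∀ x → enum (index x) ≡ x
    enum-index x = proj₂ (proj₂ (proj₂ size) x)

  _≟_ : DecidableEquality Carrier
  x ≟ y = Dec.map′ (λ i≡j → trans (sym (enum-index x)) (trans (cong enum i≡j) (enum-index y)))
                   (cong index) (index x Fin.≟ index y)

  module _ {ξ} (prim : IsPrimitive ξ) where

    log : ∀ {x} → x ≢ 0# → ℕ
    log x≢0 = proj₁ (proj₂ prim _ x≢0)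

    ξ^log : ∀ {x} (x≢0 : x ≢ 0#) → ξ ^ log x≢0 ≡ x
    ξ^log x≢0 = proj₂ (proj₂ prim _ x≢0)

    -- Sending 0 to 0 and ξ^j to 1 + (j mod n) is injective when ξ^n = 1.
    ξ^n≡1⇒q≤1+n : ∀ {n} .{{_ : NonZero n}} → ξ ^ n ≡ 1# → q ≤ suc n
    ξ^n≡1⇒q≤1+n {n} ξ^n≡1 =
      injective⇒≤ {f = code ∘ enum} (λ {i} {j} eq → enum-injective i j (code-injective eq))
      where
      residue : ∀ {x} → x ≢ 0# → Fin n
      residue x≢0 = fromℕ< (m%n<n (log x≢0) n)

      ξ^residue : ∀ {x} (x≢0 : x ≢ 0#) → ξ ^ toℕ (residue x≢0) ≡ x
      ξ^residue x≢0 = begin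
        ξ ^ toℕ (residue x≢0)   ≡⟨ cong (ξ ^_) (toℕ-fromℕ< (m%n<n (log x≢0) n)) ⟩
        ξ ^ (log x≢0 % n)       ≡⟨ sym (x^n≡1⇒x^m≡x^[m%n] ξ^n≡1 (log x≢0)) ⟩
        ξ ^ log x≢0             ≡⟨ ξ^log x≢0 ⟩
        _                       ∎

      code : Carrier → Fin (suc n)
      code x with x ≟ 0#
      ... | yes _   = zero
      ... | no x≢0  = suc (residue x≢0)

      code-injective : ∀ {x y} → code x ≡ code y → x ≡ y
      code-injective {x} {y} eq with x ≟ 0# | y ≟ 0#
      ... | yes x≡0 | yes y≡0 = trans x≡0 (sym y≡0)
      ... | no x≢0  | no y≢0  = begin
        x                        ≡⟨ sym (ξ^residue x≢0) ⟩
        ξ ^ toℕ (residue x≢0)    ≡⟨ cong (λ i → ξ ^ toℕ i) (suc-injective eq) ⟩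
        ξ ^ toℕ (residue y≢0)    ≡⟨ ξ^residue y≢0 ⟩
        y                        ∎

    ξ^n≢1 : ∀ {n} → 0 < n → suc n < q → ξ ^ n ≢ 1#
    ξ^n≢1 {n} 0<n 1+n<q ξ^n≡1 = ℕP.<⇒≱ 1+n<q (ξ^n≡1⇒q≤1+n {{ℕ.>-nonZero 0<n}} ξ^n≡1)

module MixedWalk (G : MixedGraph) where
  open MixedGraph G

  infixr 5 _∷_

  data Walk : V → V → ℕ → Set where
    []  : ∀ {u} → Walk u u 0
    _∷_ : ∀ {u v w n} → Step u v → Walk v w n → Walk u w (suc n)

  edgeCount arcCount : ∀ {u v n} → Walk u v n → ℕ
  edgeCount []           = 0
  edgeCount (edge _ ∷ w) = suc (edgeCount w)
  edgeCount (arc _ ∷ w)  = edgeCount w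
  arcCount []            = 0
  arcCount (edge _ ∷ w)  = arcCount w
  arcCount (arc _ ∷ w)   = suc (arcCount w)

  edgeCount+arcCount≡length : ∀ {u v n} (w : Walk u v n) → edgeCount w ℕ.+ arcCount w ≡ n
  edgeCount+arcCount≡length []           = refl
  edgeCount+arcCount≡length (edge _ ∷ w) = cong suc (edgeCount+arcCount≡length w)
  edgeCount+arcCount≡length (arc _ ∷ w)  =
    trans (ℕP.+-suc (edgeCount w) (arcCount w)) (cong suc (edgeCount+arcCount≡length w))

module Hq (F : Field) (k : ℕ) (ξ : Field.Carrier F) (ξ≢0 : ξ ≢ Field.0# F) where
  open Field F
  open FieldProperties F
  open IsCommutativeRing isCommutativeRing using (*-identityˡ; *-identityʳ; +-identityʳ)
  open Construction F k ξ
  open MixedGraph H using (Edge; Step; edge; arc; IsEdgeStep; Cycle; HasGirth; next)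
  open ≡-Reasoning

  point-cong : ∀ {x x' y y'} .{p : x ≢ 0#} .{p' : x' ≢ 0#} → x ≡ x' → y ≡ y' → point x p y ≡ point x' p' y'
  point-cong refl refl = refl

  line-cong : ∀ {m m' b b'} .{p : m ≢ 0#} .{p' : m' ≢ 0#} → m ≡ m' → b ≡ b' → line m p b ≡ line m' p' b'
  line-cong refl refl = refl

  L-cong : ∀ {i i'} .{p : i ≢ 0#} .{p' : i' ≢ 0#} → i ≡ i' → L i p ≡ L i' p'
  L-cong refl = refl

  P-cong : ∀ {i i'} .{p : i ≢ 0#} .{p' : i' ≢ 0#} → i ≡ i' → P i p ≡ P i' p'
  P-cong refl = refl

  twist : ℕ → Vtx → Vtx
  twist S (point x x≢0 y) = point (x * ξ ^ S) (x*y≢0 x≢0 (x^n≢0 S ξ≢0)) y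
  twist S (line m m≢0 b)  = line (m / (ξ ^ S)) (x/y≢0 m≢0 (x^n≢0 S ξ≢0)) b
  twist S (L i i≢0)       = L (i * ξ ^ S) (x*y≢0 i≢0 (x^n≢0 S ξ≢0))
  twist S (P m m≢0)       = P (m / (ξ ^ S)) (x/y≢0 m≢0 (x^n≢0 S ξ≢0))

  twist-zero : ∀ u → twist 0 u ≡ u
  twist-zero (point x _ y) = point-cong (*-identityʳ x) refl
  twist-zero (line m _ b)  = line-cong (x/1≡x m) refl
  twist-zero (L i _)       = L-cong (*-identityʳ i)
  twist-zero (P m _)       = P-cong (x/1≡x m)

  twist-twist : ∀ S T u → twist T (twist S u) ≡ twist (S ℕ.+ T) u
  twist-twist S T (point x _ y) = point-cong (x*y^m*y^n≡x*y^[m+n] x ξ S T) refl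
  twist-twist S T (line m _ b)  = line-cong (x/y^m/y^n≡x/y^[m+n] m S T ξ≢0) refl
  twist-twist S T (L i _)       = L-cong (x*y^m*y^n≡x*y^[m+n] i ξ S T)
  twist-twist S T (P m _)       = P-cong (x/y^m/y^n≡x/y^[m+n] m S T ξ≢0)

  arc⇒twist : ∀ {u v} → Arc u v → ∃[ i ] InRange i × v ≡ twist i u
  arc⇒twist {point _ _ _} {point _ _ _} (i , i∈ , x'≡ , y'≡) = i , i∈ , point-cong x'≡ y'≡
  arc⇒twist {line _ _ _}  {line _ _ _}  (i , i∈ , m'≡ , b'≡) = i , i∈ , line-cong m'≡ b'≡
  arc⇒twist {L _ _}       {L _ _}       (i , i∈ , i'≡)       = i , i∈ , L-cong i'≡
  arc⇒twist {P _ _}       {P _ _}       (i , i∈ , m'≡)       = i , i∈ , P-cong m'≡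
  arc⇒twist {point _ _ _} {line _ _ _}  ()
  arc⇒twist {point _ _ _} {L _ _}       ()
  arc⇒twist {point _ _ _} {P _ _}       ()
  arc⇒twist {line _ _ _}  {point _ _ _} ()
  arc⇒twist {line _ _ _}  {L _ _}       ()
  arc⇒twist {line _ _ _}  {P _ _}       ()
  arc⇒twist {L _ _}       {point _ _ _} ()
  arc⇒twist {L _ _}       {line _ _ _}  ()
  arc⇒twist {L _ _}       {P _ _}       ()
  arc⇒twist {P _ _}       {point _ _ _} ()
  arc⇒twist {P _ _}       {line _ _ _}  ()
  arc⇒twist {P _ _}       {L _ _}       ()

  -- Edge as an inductive family: matching on an adjacency fixes the kinds of both endpoints.
  data Adj : Vtx → Vtx → Set where
    point-line : ∀ {x y m b} .{p : x ≢ 0#} .{l : m ≢ 0#} → y ≡ m * x + b → Adj (point x p y) (line m l b)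
    line-point : ∀ {x y m b} .{p : x ≢ 0#} .{l : m ≢ 0#} → y ≡ m * x + b → Adj (line m l b) (point x p y)
    point-L    : ∀ {x y i} .{p : x ≢ 0#} .{l : i ≢ 0#} → i ≡ x → Adj (point x p y) (L i l)
    L-point    : ∀ {x y i} .{p : x ≢ 0#} .{l : i ≢ 0#} → i ≡ x → Adj (L i l) (point x p y)
    line-P     : ∀ {m b i} .{l : m ≢ 0#} .{p : i ≢ 0#} → i ≡ m → Adj (line m l b) (P i p)
    P-line     : ∀ {m b i} .{l : m ≢ 0#} .{p : i ≢ 0#} → i ≡ m → Adj (P i p) (line m l b)

  Adj-sym : ∀ {u v} → Adj u v → Adj v u
  Adj-sym (point-line e) = line-point e
  Adj-sym (line-point e) = point-line e
  Adj-sym (point-L e)    = L-point e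
  Adj-sym (L-point e)    = point-L e
  Adj-sym (line-P e)     = P-line e
  Adj-sym (P-line e)     = line-P e

  inc⇒adj : ∀ {u v} → Inc u v → Adj u v
  inc⇒adj {point _ _ _} {line _ _ _}  e = point-line e
  inc⇒adj {point _ _ _} {L _ _}       e = point-L e
  inc⇒adj {line _ _ _}  {P _ _}       e = line-P e
  inc⇒adj {point _ _ _} {point _ _ _} ()
  inc⇒adj {point _ _ _} {P _ _}       ()
  inc⇒adj {line _ _ _}  {point _ _ _} ()
  inc⇒adj {line _ _ _}  {line _ _ _}  ()
  inc⇒adj {line _ _ _}  {L _ _}       ()
  inc⇒adj {L _ _}                     ()
  inc⇒adj {P _ _}                     ()

  edge⇒adj : ∀ {u v} → Edge u v → Adj u v
  edge⇒adj (inj₁ e) = inc⇒adj e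
  edge⇒adj (inj₂ e) = Adj-sym (inc⇒adj e)

  twist-Adj : ∀ S {u v} → Adj u v → Adj (twist S u) (twist S v)
  twist-Adj S (point-line {x} {m = m} {b} e) =
    point-line (trans e (cong (_+ b) (sym (x/y*[z*y]≡x*z m x (x^n≢0 S ξ≢0)))))
  twist-Adj S (line-point {x} {m = m} {b} e) =
    line-point (trans e (cong (_+ b) (sym (x/y*[z*y]≡x*z m x (x^n≢0 S ξ≢0)))))
  twist-Adj S (point-L e) = point-L (cong (_* ξ ^ S) e)
  twist-Adj S (L-point e) = L-point (cong (_* ξ ^ S) e)
  twist-Adj S (line-P e)  = line-P (cong (_/ (ξ ^ S)) e)
  twist-Adj S (P-line e)  = P-line (cong (_/ (ξ ^ S)) e)

  side : Vtx → Bool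
  side (point _ _ _) = true
  side (P _ _)       = true
  side (line _ _ _)  = false
  side (L _ _)       = false

  Adj-side : ∀ {u v} → Adj u v → side v ≡ not (side u)
  Adj-side (point-line _) = refl
  Adj-side (line-point _) = refl
  Adj-side (point-L _)    = refl
  Adj-side (L-point _)    = refl
  Adj-side (line-P _)     = refl
  Adj-side (P-line _)     = refl

  side-twist : ∀ S u → side (twist S u) ≡ side u
  side-twist S (point _ _ _) = refl
  side-twist S (line _ _ _)  = refl
  side-twist S (L _ _)       = refl
  side-twist S (P _ _)       = refl

  AdjWalk : Vtx → Vtx → ℕ → Set
  AdjWalk u v zero    = u ≡ v
  AdjWalk u v (suc e) = ∃[ w ] Adj u w × AdjWalk w v e

  odd-walk-switches-side : ∀ e {u v} → AdjWalk u v (suc (e ℕ.* 2)) → side v ≡ not (side u)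
  odd-walk-switches-side zero        (_ , a , refl)         = Adj-side a
  odd-walk-switches-side (suc e) {u} (_ , a , _ , a' , p) = begin
    _                         ≡⟨ odd-walk-switches-side e p ⟩
    not (side _)              ≡⟨ cong not (Adj-side a') ⟩
    not (not (side _))        ≡⟨ cong (not ∘ not) (Adj-side a) ⟩
    not (not (not (side u)))  ≡⟨ cong not (not-involutive (side u)) ⟩
    not (side u)              ∎

  coord : Vtx → Carrier
  coord (point x _ _) = x
  coord (line m _ _)  = m
  coord (L i _)       = i
  coord (P m _)       = m

  twist-fixed⇒ξ^S≡1 : ∀ S u → twist S u ≡ u → ξ ^ S ≡ 1#
  twist-fixed⇒ξ^S≡1 S (point x p _) eq = x*y≡x⇒y≡1 (¬-recompute p) (cong coord eq)
  twist-fixed⇒ξ^S≡1 S (line m p _)  eq = x/y≡x⇒y≡1 (¬-recompute p) (x^n≢0 S ξ≢0) (cong coord eq)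
  twist-fixed⇒ξ^S≡1 S (L i p)       eq = x*y≡x⇒y≡1 (¬-recompute p) (cong coord eq)
  twist-fixed⇒ξ^S≡1 S (P m p)       eq = x/y≡x⇒y≡1 (¬-recompute p) (x^n≢0 S ξ≢0) (cong coord eq)

  twist-no-common-neighbour : ∀ {S u w} → ξ ^ S ≢ 1# → Adj (twist S u) w → Adj w u → ⊥
  twist-no-common-neighbour ξ^S≢1 (point-line e') (line-point {x} {m = m} {b} {p} {l} e) =
    ξ^S≢1 (x*y≡x⇒y≡1 (¬-recompute p)
      (sym (*-almostCancelˡ m _ _ (¬-recompute l) (+-cancelʳ b _ _ (trans (sym e) e')))))
  twist-no-common-neighbour {S} ξ^S≢1 (line-point e') (point-line {x} {m = m} {b} {p} {l} e) =
    ξ^S≢1 (x/y≡x⇒y≡1 (¬-recompute l) (x^n≢0 S ξ≢0)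
      (*-almostCancelʳ x _ _ (¬-recompute p) (+-cancelʳ b _ _ (trans (sym e') e))))
  twist-no-common-neighbour ξ^S≢1 (point-L e') (L-point {p = p} e) =
    ξ^S≢1 (x*y≡x⇒y≡1 (¬-recompute p) (trans (sym e') e))
  twist-no-common-neighbour ξ^S≢1 (L-point e') (point-L {l = l} e) =
    ξ^S≢1 (x*y≡x⇒y≡1 (¬-recompute l) (trans e' (sym e)))
  twist-no-common-neighbour {S} ξ^S≢1 (line-P e') (P-line {l = l} e) =
    ξ^S≢1 (x/y≡x⇒y≡1 (¬-recompute l) (x^n≢0 S ξ≢0) (trans (sym e') e))
  twist-no-common-neighbour {S} ξ^S≢1 (P-line e') (line-P {p = p} e) =
    ξ^S≢1 (x/y≡x⇒y≡1 (¬-recompute p) (x^n≢0 S ξ≢0) (trans e' (sym e)))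

  lines-meet-once : ∀ {x₀ y₀ x₂ y₂ m b m' b'} .{p₀ : x₀ ≢ 0#} .{p₂ : x₂ ≢ 0#} .{l : m ≢ 0#} .{l' : m' ≢ 0#} →
    line m l b ≢ line m' l' b' →
    y₀ ≡ m * x₀ + b → y₂ ≡ m * x₂ + b → y₀ ≡ m' * x₀ + b' → y₂ ≡ m' * x₂ + b' →
    point x₀ p₀ y₀ ≡ point x₂ p₂ y₂
  lines-meet-once {x₀} {y₀} {x₂} {y₂} {m} {b} {m'} ℓ≢ℓ' e₀ e₂ e₀' e₂' = point-cong x₀≡x₂ y₀≡y₂
    where
    m≢m' : m ≢ m'
    m≢m' refl = ℓ≢ℓ' (line-cong refl (+-cancelˡ _ _ _ (trans (sym e₀) e₀')))
    x₀≡x₂ : x₀ ≡ x₂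
    x₀≡x₂ = affine-agree-once m≢m' (trans (sym e₀) e₀') (trans (sym e₂) e₂')
    y₀≡y₂ : y₀ ≡ y₂
    y₀≡y₂ = trans e₀ (trans (cong (λ x → m * x + b) x₀≡x₂) (sym e₂))

  vertical-meets-line-once : ∀ {x₀ y₀ x₂ y₂ i m b} .{p₀ : x₀ ≢ 0#} .{p₂ : x₂ ≢ 0#} →
    i ≡ x₀ → i ≡ x₂ → y₀ ≡ m * x₀ + b → y₂ ≡ m * x₂ + b → point x₀ p₀ y₀ ≡ point x₂ p₂ y₂
  vertical-meets-line-once {m = m} {b} refl refl e₀ e₂ = point-cong refl (trans e₀ (sym e₂))

  parallels-through-point-coincide : ∀ {m₀ b₀ m₂ b₂ i x y} .{l₀ : m₀ ≢ 0#} .{l₂ : m₂ ≢ 0#} →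
    i ≡ m₀ → i ≡ m₂ → y ≡ m₀ * x + b₀ → y ≡ m₂ * x + b₂ → line m₀ l₀ b₀ ≡ line m₂ l₂ b₂
  parallels-through-point-coincide refl refl e₀ e₂ = line-cong refl (+-cancelˡ _ _ _ (trans (sym e₀) e₂))

  no-quadrangle : ∀ {v₀ v₁ v₂ v₃} → Adj v₀ v₁ → Adj v₁ v₂ → Adj v₂ v₃ → Adj v₃ v₀ →
                  v₀ ≢ v₂ → v₁ ≢ v₃ → ⊥
  no-quadrangle (point-line e₀) (line-point e₁) (point-line e₂) (line-point e₃) v₀≢v₂ v₁≢v₃ =
    v₀≢v₂ (lines-meet-once v₁≢v₃ e₀ e₁ e₃ e₂)
  no-quadrangle (point-line e₀) (line-P e₁) (P-line e₂) (line-point e₃) v₀≢v₂ v₁≢v₃ =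
    v₁≢v₃ (parallels-through-point-coincide e₁ e₂ e₀ e₃)
  no-quadrangle (point-line e₀) (line-point e₁) (point-L e₂) (L-point e₃) v₀≢v₂ v₁≢v₃ =
    v₀≢v₂ (vertical-meets-line-once e₃ e₂ e₀ e₁)
  no-quadrangle (point-L e₀) (L-point e₁) (point-line e₂) (line-point e₃) v₀≢v₂ v₁≢v₃ =
    v₀≢v₂ (vertical-meets-line-once e₀ e₁ e₃ e₂)
  no-quadrangle (point-L e₀) (L-point e₁) (point-L e₂) (L-point e₃) v₀≢v₂ v₁≢v₃ =
    v₁≢v₃ (L-cong (trans e₀ (sym e₃)))
  no-quadrangle (line-point e₀) (point-line e₁) (line-point e₂) (point-line e₃) v₀≢v₂ v₁≢v₃ =
    v₁≢v₃ (lines-meet-once v₀≢v₂ e₀ e₃ e₁ e₂)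
  no-quadrangle (line-point e₀) (point-L e₁) (L-point e₂) (point-line e₃) v₀≢v₂ v₁≢v₃ =
    v₁≢v₃ (vertical-meets-line-once e₁ e₂ e₀ e₃)
  no-quadrangle (line-point e₀) (point-line e₁) (line-P e₂) (P-line e₃) v₀≢v₂ v₁≢v₃ =
    v₀≢v₂ (parallels-through-point-coincide e₃ e₂ e₀ e₁)
  no-quadrangle (line-P e₀) (P-line e₁) (line-point e₂) (point-line e₃) v₀≢v₂ v₁≢v₃ =
    v₀≢v₂ (parallels-through-point-coincide e₀ e₁ e₃ e₂)
  no-quadrangle (line-P e₀) (P-line e₁) (line-P e₂) (P-line e₃) v₀≢v₂ v₁≢v₃ =
    v₁≢v₃ (P-cong (trans e₀ (sym e₃)))
  no-quadrangle (L-point e₀) (point-line e₁) (line-point e₂) (point-L e₃) v₀≢v₂ v₁≢v₃ =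
    v₁≢v₃ (vertical-meets-line-once e₀ e₃ e₁ e₂)
  no-quadrangle (L-point e₀) (point-L e₁) (L-point e₂) (point-L e₃) v₀≢v₂ v₁≢v₃ =
    v₀≢v₂ (L-cong (trans e₀ (sym e₁)))
  no-quadrangle (P-line e₀) (line-point e₁) (point-line e₂) (line-P e₃) v₀≢v₂ v₁≢v₃ =
    v₁≢v₃ (parallels-through-point-coincide e₀ e₃ e₁ e₂)
  no-quadrangle (P-line e₀) (line-P e₁) (P-line e₂) (line-P e₃) v₀≢v₂ v₁≢v₃ =
    v₀≢v₂ (P-cong (trans e₀ (sym e₁)))

  open MixedWalk H

  exponent : ∀ {u v n} → Walk u v n → ℕ
  exponent []           = 0
  exponent (edge _ ∷ w) = exponent w
  exponent (arc a ∷ w)  = proj₁ (arc⇒twist a) ℕ.+ exponent w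

  arcCount≤exponent : ∀ {u v n} (w : Walk u v n) → arcCount w ≤ exponent w
  arcCount≤exponent []           = z≤n
  arcCount≤exponent (edge _ ∷ w) = arcCount≤exponent w
  arcCount≤exponent (arc a ∷ w)  = ℕP.+-mono-≤ (proj₁ (proj₁ (proj₂ (arc⇒twist a)))) (arcCount≤exponent w)

  exponent≤arcCount*k : ∀ {u v n} (w : Walk u v n) → exponent w ≤ arcCount w ℕ.* k
  exponent≤arcCount*k []           = z≤n
  exponent≤arcCount*k (edge _ ∷ w) = exponent≤arcCount*k w
  exponent≤arcCount*k (arc a ∷ w)  = ℕP.+-mono-≤ (proj₂ (proj₁ (proj₂ (arc⇒twist a)))) (exponent≤arcCount*k w)

  -- Moving each vertex by the twist still to come collapses arcs and, σ being an automorphism, keeps edges.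
  lift : ∀ {u v n} (w : Walk u v n) → AdjWalk (twist (exponent w) u) v (edgeCount w)
  lift {u} []           = twist-zero u
  lift (edge e ∷ w)     = _ , twist-Adj (exponent w) (edge⇒adj e) , lift w
  lift {u} {v} (arc a ∷ w) with arc⇒twist a
  ... | i , _ , refl    = subst (λ t → AdjWalk t v (edgeCount w)) (twist-twist i (exponent w) u) (lift w)

  far-from-twist : ∀ {S} → ξ ^ S ≢ 1# → ∀ {u} e → e ≤ 3 → ¬ AdjWalk (twist S u) u e
  far-from-twist ξ^S≢1 {u} 0 _ p = ξ^S≢1 (twist-fixed⇒ξ^S≡1 _ u p)
  far-from-twist {S} _ {u} 1 _ p = not-¬ refl (trans (odd-walk-switches-side 0 p) (cong not (side-twist S u)))
  far-from-twist ξ^S≢1 2 _ (_ , a , _ , a' , refl) = twist-no-common-neighbour ξ^S≢1 a a'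
  far-from-twist {S} _ {u} 3 _ p = not-¬ refl (trans (odd-walk-switches-side 1 p) (cong not (side-twist S u)))
  far-from-twist _ (suc (suc (suc (suc _)))) (s≤s (s≤s (s≤s ())))

  module _ (ξ^S≢1 : ∀ {S} → 1 ≤ S → S ≤ 4 ℕ.* k → ξ ^ S ≢ 1#) where

    no-short-closed-walk-with-arc : ∀ {v n} (w : Walk v v n) → n ≤ 4 → 1 ≤ arcCount w → ⊥
    no-short-closed-walk-with-arc w n≤4 1≤a =
      far-from-twist (ξ^S≢1 1≤S S≤4k) (edgeCount w) e≤3 (lift w)
      where
      e+a≡n : edgeCount w ℕ.+ arcCount w ≡ _
      e+a≡n = edgeCount+arcCount≡length w
      a≤4 : arcCount w ≤ 4
      a≤4 = ℕP.≤-trans (subst (arcCount w ≤_) e+a≡n (ℕP.m≤n+m _ _)) n≤4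
      S≤4k : exponent w ≤ 4 ℕ.* k
      S≤4k = ℕP.≤-trans (exponent≤arcCount*k w) (ℕP.*-monoˡ-≤ k a≤4)
      1≤S : 1 ≤ exponent w
      1≤S = ℕP.≤-trans 1≤a (arcCount≤exponent w)
      e≤3 : edgeCount w ≤ 3
      e≤3 = ℕ.s≤s⁻¹ (ℕP.<-≤-trans (subst (edgeCount w ℕ.<_) e+a≡n (ℕP.m<m+n _ 1≤a)) n≤4)

    no-1-cycle : ∀ {v₀} → Step v₀ v₀ → ⊥
    no-1-cycle (edge e)   = not-¬ refl (odd-walk-switches-side 0 (_ , edge⇒adj e , refl))
    no-1-cycle s₀@(arc _) = no-short-closed-walk-with-arc (s₀ ∷ []) (ℕP.m≤m+n _ _) (s≤s z≤n)

    no-2-cycle : ∀ {v₀ v₁} (s₀ : Step v₀ v₁) (s₁ : Step v₁ v₀) →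
                 (IsEdgeStep s₀ → IsEdgeStep s₁ → ⊥) → ⊥
    no-2-cycle (edge _)    (edge _)   edges-once = edges-once tt tt
    no-2-cycle s₀@(arc _)  s₁         _ =
      no-short-closed-walk-with-arc (s₀ ∷ s₁ ∷ []) (ℕP.m≤m+n _ _) (s≤s z≤n)
    no-2-cycle s₀@(edge _) s₁@(arc _) _ =
      no-short-closed-walk-with-arc (s₀ ∷ s₁ ∷ []) (ℕP.m≤m+n _ _) (s≤s z≤n)

    no-3-cycle : ∀ {v₀ v₁ v₂} → Step v₀ v₁ → Step v₁ v₂ → Step v₂ v₀ → ⊥
    no-3-cycle (edge e₀) (edge e₁) (edge e₂) =
      not-¬ refl (odd-walk-switches-side 1 (_ , edge⇒adj e₀ , _ , edge⇒adj e₁ , _ , edge⇒adj e₂ , refl))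
    no-3-cycle s₀@(arc _)  s₁          s₂         =
      no-short-closed-walk-with-arc (s₀ ∷ s₁ ∷ s₂ ∷ []) (ℕP.m≤m+n _ _) (s≤s z≤n)
    no-3-cycle s₀@(edge _) s₁@(arc _)  s₂         =
      no-short-closed-walk-with-arc (s₀ ∷ s₁ ∷ s₂ ∷ []) (ℕP.m≤m+n _ _) (s≤s z≤n)
    no-3-cycle s₀@(edge _) s₁@(edge _) s₂@(arc _) =
      no-short-closed-walk-with-arc (s₀ ∷ s₁ ∷ s₂ ∷ []) (ℕP.m≤m+n _ _) (s≤s z≤n)

    no-4-cycle : ∀ {v₀ v₁ v₂ v₃} → Step v₀ v₁ → Step v₁ v₂ → Step v₂ v₃ → Step v₃ v₀ →
                 v₀ ≢ v₂ → v₁ ≢ v₃ → ⊥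
    no-4-cycle (edge e₀) (edge e₁) (edge e₂) (edge e₃) =
      no-quadrangle (edge⇒adj e₀) (edge⇒adj e₁) (edge⇒adj e₂) (edge⇒adj e₃)
    no-4-cycle s₀@(arc _)  s₁          s₂          s₃         _ _ =
      no-short-closed-walk-with-arc (s₀ ∷ s₁ ∷ s₂ ∷ s₃ ∷ []) (ℕP.m≤m+n _ _) (s≤s z≤n)
    no-4-cycle s₀@(edge _) s₁@(arc _)  s₂          s₃         _ _ =
      no-short-closed-walk-with-arc (s₀ ∷ s₁ ∷ s₂ ∷ s₃ ∷ []) (ℕP.m≤m+n _ _) (s≤s z≤n)
    no-4-cycle s₀@(edge _) s₁@(edge _) s₂@(arc _)  s₃         _ _ =
      no-short-closed-walk-with-arc (s₀ ∷ s₁ ∷ s₂ ∷ s₃ ∷ []) (ℕP.m≤m+n _ _) (s≤s z≤n)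
    no-4-cycle s₀@(edge _) s₁@(edge _) s₂@(edge _) s₃@(arc _) _ _ =
      no-short-closed-walk-with-arc (s₀ ∷ s₁ ∷ s₂ ∷ s₃ ∷ []) (ℕP.m≤m+n _ _) (s≤s z≤n)

    no-short-cycle : ∀ n → n < 5 → ¬ Cycle n
    no-short-cycle 0 _ record { n≥1 = () }
    no-short-cycle 1 _ c = no-1-cycle (step (# 0))
      where open Cycle c
    no-short-cycle 2 _ c =
      no-2-cycle (step (# 0)) (step (# 1)) (λ e₀ e₁ → edgesOnce (# 0) (# 1) (λ ()) e₀ e₁ (refl , refl))
      where open Cycle c
    no-short-cycle 3 _ c = no-3-cycle (step (# 0)) (step (# 1)) (step (# 2))
      where open Cycle c
    no-short-cycle 4 _ c =
      no-4-cycle (step (# 0)) (step (# 1)) (step (# 2)) (step (# 3))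
        (λ eq → case distinct (# 0) (# 2) eq of λ ()) (λ eq → case distinct (# 1) (# 3) eq of λ ())
      where open Cycle c
    no-short-cycle (suc (suc (suc (suc (suc _))))) (s≤s (s≤s (s≤s (s≤s (s≤s ()))))) _

  module _ (1≤k : 1 ≤ k) (ξ≢1 : ξ ≢ 1#) where

    1*x+0≡x : ∀ x → 1# * x + 0# ≡ x
    1*x+0≡x x = trans (+-identityʳ (1# * x)) (*-identityˡ x)

    pentagon : Fin 5 → Vtx
    pentagon zero                         = L 1# 1≢0
    pentagon (suc zero)                   = L ξ ξ≢0
    pentagon (suc (suc zero))             = point ξ ξ≢0 ξ
    pentagon (suc (suc (suc zero)))       = line 1# 1≢0 0#
    pentagon (suc (suc (suc (suc zero)))) = point 1# 1≢0 1#

    pentagon-step : ∀ i → Step (pentagon i) (pentagon (next i))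
    pentagon-step zero                         = arc (1 , (ℕP.≤-refl , 1≤k) , sym 1*ξ^1≡ξ)
      where
      1*ξ^1≡ξ : 1# * ξ ^ 1 ≡ ξ
      1*ξ^1≡ξ = trans (*-identityˡ (ξ * 1#)) (*-identityʳ ξ)
    pentagon-step (suc zero)                   = edge (inj₂ refl)
    pentagon-step (suc (suc zero))             = edge (inj₁ (sym (1*x+0≡x ξ)))
    pentagon-step (suc (suc (suc zero)))       = edge (inj₂ (sym (1*x+0≡x 1#)))
    pentagon-step (suc (suc (suc (suc zero)))) = edge (inj₁ refl)

    pentagon-injective : ∀ i j → pentagon i ≡ pentagon j → i ≡ j
    pentagon-injective zero zero _ = refl
    pentagon-injective zero (suc zero) eq = ⊥-elim (ξ≢1 (sym (cong coord eq)))
    pentagon-injective zero (suc (suc zero)) ()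
    pentagon-injective zero (suc (suc (suc zero))) ()
    pentagon-injective zero (suc (suc (suc (suc zero)))) ()
    pentagon-injective (suc zero) zero eq = ⊥-elim (ξ≢1 (cong coord eq))
    pentagon-injective (suc zero) (suc zero) _ = refl
    pentagon-injective (suc zero) (suc (suc zero)) ()
    pentagon-injective (suc zero) (suc (suc (suc zero))) ()
    pentagon-injective (suc zero) (suc (suc (suc (suc zero)))) ()
    pentagon-injective (suc (suc zero)) zero ()
    pentagon-injective (suc (suc zero)) (suc zero) ()
    pentagon-injective (suc (suc zero)) (suc (suc zero)) _ = refl
    pentagon-injective (suc (suc zero)) (suc (suc (suc zero))) ()
    pentagon-injective (suc (suc zero)) (suc (suc (suc (suc zero)))) eq = ⊥-elim (ξ≢1 (cong coord eq))
    pentagon-injective (suc (suc (suc zero))) zero ()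
    pentagon-injective (suc (suc (suc zero))) (suc zero) ()
    pentagon-injective (suc (suc (suc zero))) (suc (suc zero)) ()
    pentagon-injective (suc (suc (suc zero))) (suc (suc (suc zero))) _ = refl
    pentagon-injective (suc (suc (suc zero))) (suc (suc (suc (suc zero)))) ()
    pentagon-injective (suc (suc (suc (suc zero)))) zero ()
    pentagon-injective (suc (suc (suc (suc zero)))) (suc zero) ()
    pentagon-injective (suc (suc (suc (suc zero)))) (suc (suc zero)) eq = ⊥-elim (ξ≢1 (sym (cong coord eq)))
    pentagon-injective (suc (suc (suc (suc zero)))) (suc (suc (suc zero))) ()
    pentagon-injective (suc (suc (suc (suc zero)))) (suc (suc (suc (suc zero)))) _ = refl

    next∘next≢id : ∀ (i : Fin 5) → next (next i) ≢ i
    next∘next≢id zero                         ()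
    next∘next≢id (suc zero)                   ()
    next∘next≢id (suc (suc zero))             ()
    next∘next≢id (suc (suc (suc zero)))       ()
    next∘next≢id (suc (suc (suc (suc zero)))) ()

    pentagon-cycle : Cycle 5
    pentagon-cycle = record
      { n≥1       = s≤s z≤n
      ; vtx       = pentagon
      ; distinct  = pentagon-injective
      ; step      = pentagon-step
      ; edgesOnce = λ i j _ _ _ (i~j' , i'~j) → next∘next≢id j
          (trans (cong next (sym (pentagon-injective i (next j) i~j'))) (pentagon-injective (next i) j i'~j))
      }

  girth-5 : 1 ≤ k → (∀ {S} → 1 ≤ S → S ≤ 4 ℕ.* k → ξ ^ S ≢ 1#) → HasGirth 5
  girth-5 1≤k ξ^S≢1 = pentagon-cycle 1≤k ξ≢1 , no-short-cycle ξ^S≢1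
    where
    ξ≢1 : ξ ≢ 1#
    ξ≢1 ξ≡1 = ξ^S≢1 (s≤s z≤n) (ℕP.≤-trans 1≤k (ℕP.m≤n*m k 4)) (trans (*-identityʳ ξ) ξ≡1)

open import Data.Nat using (ℕ; suc; _+_; _*_; _^_; _≤_)

mainTheorem1 : (q : ℕ) → (∃[ p ] ∃[ e ] (Prime p × q ≡ p ^ suc e)) → 7 ≤ q →
    (k : ℕ) → 1 ≤ k → (R : ℕ) → 1 ≤ R → R ≤ 5 → q ≡ suc (4 * k + R) →
    (F : Field) → HasSize F q → (ξ : Field.Carrier F) → Field.IsPrimitive F ξ →
    MixedGraph.HasGirth (Construction.H F k ξ) 5
mainTheorem1 q _ _ k 1≤k R 1≤R _ q≡1+4k+R F size ξ ξ-primitive =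
  Hq.girth-5 F k ξ (proj₁ ξ-primitive) 1≤k
    (λ 0<S S≤4k → FiniteField.ξ^n≢1 F size ξ-primitive 0<S (1+S<q S≤4k))
  where
  1+S<q : ∀ {S} → S ≤ 4 * k → suc S < q
  1+S<q {S} S≤4k = subst (suc S <_) (sym q≡1+4k+R)
    (s≤s (subst (suc S ≤_) (ℕP.+-comm R (4 * k)) (ℕP.+-mono-≤ 1≤R S≤4k)))
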